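{- Let $G$ be a finite non-abelian group such that for every $g\in G\setminus Z(G)$ there exists a unique $\mu$-subgroup $C^*_g$ of the centralizer $C_G(g)$ containing both $g$ and $Z(G)$. Then $G$ is a flower group with pistil $Z(G)$, and its set of petals equals $\{C^*_g : g\in G\setminus Z(G)\}$.
   Context: A cyclic subgroup $H$ of a group $K$ is a $\mu$-subgroup of $K$ if it is not contained in any cyclic subgroup of $K$ other than $H$ itself. A finite noncyclic group $G$, whose set of $\mu$-subgroups is $\{C_1,\ldots,C_k\}$, is a flower group if there is a subgroup $C_0$ of $G$ with $C_i\cap C_j=C_0$ for all $1\le i<j\le k$; $C_0$ is the pistil and $C_1,\ldots,C_k$ the petals. -}

module Defs where

open import Level using (0ℓ)
open import Data.Nat using (ℕ; zero; suc)
open import Data.Fin using (Fin)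
open import Data.Product using (Σ; ∃; _×_; _,_; proj₁)
open import Relation.Nullary using (¬_)
open import Relation.Unary using (Pred; _⊆_; _≐_; _∩_)
open import Relation.Binary.PropositionalEquality using (_≡_)
open import Algebra.Structures using (IsGroup)

record FiniteGroup : Set where
  infixl 7 _∙_
  field
    order   : ℕ
    _∙_     : Fin order → Fin order → Fin order
    ε       : Fin order
    _⁻¹     : Fin order → Fin order
    isGroup : IsGroup _≡_ _∙_ ε _⁻¹

module _ (G : FiniteGroup) where
  open FiniteGroup G

  Elt : Set
  Elt = Fin order

  Subset : Set₁
  Subset = Pred Elt 0ℓ

  pow : Elt → ℕ → Elt
  pow g zero    = ε
  pow g (suc k) = g ∙ pow g k

  -- cyclic subgroup generated by g (G finite, so nonnegative powers suffice)
  ⟨_⟩ : Elt → Subset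
  ⟨ g ⟩ x = ∃ λ k → pow g k ≡ x

  IsSubgroup : Subset → Set
  IsSubgroup H = H ε × (∀ {x y} → H x → H y → H (x ∙ y)) × (∀ {x} → H x → H (x ⁻¹))

  Abelian : Set
  Abelian = ∀ x y → x ∙ y ≡ y ∙ x

  Cyclic : Set
  Cyclic = ∃ λ g → ∀ x → ⟨ g ⟩ x

  Z : Subset
  Z x = ∀ y → x ∙ y ≡ y ∙ x

  Centralizer : Elt → Subset
  Centralizer g x = x ∙ g ≡ g ∙ x

  IsMuSubgroupOf : Subset → Subset → Set
  IsMuSubgroupOf K H =
    (∃ λ h → K h × (H ≐ ⟨ h ⟩)) ×
    (∀ c → K c → H ⊆ ⟨ c ⟩ → ⟨ c ⟩ ≐ H)

  IsMu : Subset → Set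
  IsMu = IsMuSubgroupOf (λ _ → Data.Unit.⊤)
    where import Data.Unit

  IsFlowerWithPistil : Subset → Set₁
  IsFlowerWithPistil C₀ =
    ¬ Cyclic × IsSubgroup C₀ ×
    (∀ (Ci Cj : Subset) → IsMu Ci → IsMu Cj → ¬ (Ci ≐ Cj) → (Ci ∩ Cj) ≐ C₀)

  IsCStar : Elt → Subset → Set₁
  IsCStar g C =
    (IsMuSubgroupOf (Centralizer g) C × C g × Z ⊆ C) ×
    (∀ (H : Subset) → IsMuSubgroupOf (Centralizer g) H → H g → Z ⊆ H → H ≐ C)

-- A μ-subgroup C = ⟨h⟩ of G is swallowed by every cyclic subgroup containing h.
-- Applied to C*_h this gives C = C*_h, hence Z(G) ⊆ C; applied to C*_x for a
-- non-central x it shows that h cannot be central, as otherwise x ∈ C ⊆ Z(G).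
-- If two petals met outside Z(G), in some x, both would be μ-subgroups of
-- C_G(x) containing x and Z(G), so both would equal C*_x by uniqueness.
module Submission where

open import Defs
open import Data.Fin using (_≟_)
open import Data.Nat using (zero; suc; _+_)
open import Data.Nat.Properties using (+-comm)
open import Data.Product using (Σ; _×_; proj₁; proj₂; _,_)
open import Data.Unit using (tt)
open import Relation.Nullary using (¬_)
open import Relation.Nullary.Decidable using (decidable-stable)
open import Relation.Unary using (_⊆_; _≐_; _∩_)
open import Relation.Unary.Properties using (≐-sym; ≐-trans)
open import Relation.Binary.PropositionalEquality
open import Algebra.Structures using (IsGroup)

module GroupFacts (G : FiniteGroup) where
  open FiniteGroup G
  open IsGroup isGroup using (assoc; identityˡ; identityʳ; inverseˡ; inverseʳ)

  private variable
    x y c g h : Elt G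
    H K : Subset G

  pow-+ : ∀ g m n → pow G g (m + n) ≡ pow G g m ∙ pow G g n
  pow-+ g zero    n = sym (identityˡ _)
  pow-+ g (suc m) n = trans (cong (g ∙_) (pow-+ g m n)) (sym (assoc g _ _))

  ∈⟨_⟩ : ∀ g → ⟨ G ⟩ g g
  ∈⟨ g ⟩ = 1 , identityʳ g

  ⟨⟩-least : H ε → (∀ {x y} → H x → H y → H (x ∙ y)) → H h → ⟨ G ⟩ h ⊆ H
  ⟨⟩-least {H} {h} Hε H∙ Hh (k , refl) = pow∈ k
    where
    pow∈ : ∀ k → H (pow G h k)
    pow∈ zero    = Hε
    pow∈ (suc k) = H∙ {h} {pow G h k} Hh (pow∈ k)

  ⟨⟩-mono : ⟨ G ⟩ c h → ⟨ G ⟩ h ⊆ ⟨ G ⟩ c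
  ⟨⟩-mono {c = c} = ⟨⟩-least (0 , refl) ∙-closed
    where
    ∙-closed : ⟨ G ⟩ c x → ⟨ G ⟩ c y → ⟨ G ⟩ c (x ∙ y)
    ∙-closed (k , refl) (l , refl) = k + l , pow-+ c k l

  ⟨⟩-commutative : ⟨ G ⟩ c x → ⟨ G ⟩ c y → x ∙ y ≡ y ∙ x
  ⟨⟩-commutative {c = c} (k , refl) (l , refl) =
    trans (sym (pow-+ c k l)) (trans (cong (pow G c) (+-comm k l)) (pow-+ c l k))

  generator-centralizes : ⟨ G ⟩ c g → Centralizer G g c
  generator-centralizes {c = c} = ⟨⟩-commutative ∈⟨ c ⟩

  cyclic⇒abelian : Cyclic G → Abelian G
  cyclic⇒abelian (c , all) x y = ⟨⟩-commutative (all x) (all y)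

  ⁻¹-commutes : x ∙ y ≡ y ∙ x → x ⁻¹ ∙ y ≡ y ∙ x ⁻¹
  ⁻¹-commutes {x} {y} xy≡yx = begin
    x ⁻¹ ∙ y                 ≡⟨ cong (x ⁻¹ ∙_) (sym (identityʳ y)) ⟩
    x ⁻¹ ∙ (y ∙ ε)           ≡⟨ cong (λ t → x ⁻¹ ∙ (y ∙ t)) (sym (inverseʳ x)) ⟩
    x ⁻¹ ∙ (y ∙ (x ∙ x ⁻¹))  ≡⟨ cong (x ⁻¹ ∙_) (sym (assoc y x _)) ⟩
    x ⁻¹ ∙ ((y ∙ x) ∙ x ⁻¹)  ≡⟨ cong (λ t → x ⁻¹ ∙ (t ∙ x ⁻¹)) (sym xy≡yx) ⟩
    x ⁻¹ ∙ ((x ∙ y) ∙ x ⁻¹)  ≡⟨ cong (x ⁻¹ ∙_) (assoc x y _) ⟩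
    x ⁻¹ ∙ (x ∙ (y ∙ x ⁻¹))  ≡⟨ sym (assoc (x ⁻¹) x _) ⟩
    (x ⁻¹ ∙ x) ∙ (y ∙ x ⁻¹)  ≡⟨ cong (_∙ (y ∙ x ⁻¹)) (inverseˡ x) ⟩
    ε ∙ (y ∙ x ⁻¹)           ≡⟨ identityˡ _ ⟩
    y ∙ x ⁻¹                 ∎
    where open ≡-Reasoning

  Z-isSubgroup : IsSubgroup G (Z G)
  Z-isSubgroup = ε-central , ∙-central , λ zx y → ⁻¹-commutes (zx y)
    where
    ε-central : Z G ε
    ε-central y = trans (identityˡ y) (sym (identityʳ y))

    ∙-central : Z G x → Z G y → Z G (x ∙ y)
    ∙-central {x} {y} zx zy w = begin
      (x ∙ y) ∙ w  ≡⟨ assoc x y w ⟩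
      x ∙ (y ∙ w)  ≡⟨ cong (x ∙_) (zy w) ⟩
      x ∙ (w ∙ y)  ≡⟨ sym (assoc x w y) ⟩
      (x ∙ w) ∙ y  ≡⟨ cong (_∙ y) (zx w) ⟩
      (w ∙ x) ∙ y  ≡⟨ assoc w x y ⟩
      w ∙ (x ∙ y)  ∎
      where open ≡-Reasoning

  ⟨central⟩⊆Z : Z G h → ⟨ G ⟩ h ⊆ Z G
  ⟨central⟩⊆Z = let (Zε , Z∙ , _) = Z-isSubgroup in ⟨⟩-least Zε Z∙

  -- Equality in Fin is decidable, so centrality may be proved by contradiction.
  Z-stable : ¬ ¬ Z G x → Z G x
  Z-stable {x} ¬¬zx y = decidable-stable (x ∙ y ≟ y ∙ x) λ ne → ¬¬zx (λ zx → ne (zx y))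

  generator : IsMuSubgroupOf G K H → Elt G
  generator ((h , _) , _) = h

  generator-spans : (m : IsMuSubgroupOf G K H) → H ≐ ⟨ G ⟩ (generator m)
  generator-spans ((_ , _ , H≐⟨h⟩) , _) = H≐⟨h⟩

  μ-absorbs : (m : IsMuSubgroupOf G K H) → K c → ⟨ G ⟩ c (generator m) → ⟨ G ⟩ c ≐ H
  μ-absorbs m@(_ , maximal) Kc hc =
    maximal _ Kc (λ Hx → ⟨⟩-mono hc (proj₁ (generator-spans m) Hx))

  μ-of-centralizer⇒μ : H g → IsMuSubgroupOf G (Centralizer G g) H → IsMu G H
  μ-of-centralizer⇒μ Hg ((h , _ , H≐⟨h⟩) , maximal) =
    (h , tt , H≐⟨h⟩) , λ c _ H⊆⟨c⟩ → maximal c (generator-centralizes (H⊆⟨c⟩ Hg)) H⊆⟨c⟩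

  μ⇒μ-of-centralizer : H g → IsMu G H → IsMuSubgroupOf G (Centralizer G g) H
  μ⇒μ-of-centralizer Hg ((h , _ , H≐⟨h⟩) , maximal) =
    (h , generator-centralizes (proj₁ H≐⟨h⟩ Hg) , H≐⟨h⟩) , λ c _ → maximal c tt

module Petals (G : FiniteGroup) (nonabelian : ¬ Abelian G)
              (hyp : (g : Elt G) → ¬ Z G g → Σ (Subset G) (IsCStar G g)) where
  open GroupFacts G

  private variable
    g : Elt G
    C Ci Cj : Subset G

  C* : (g : Elt G) → ¬ Z G g → Subset G
  C* g ng = proj₁ (hyp g ng)

  C*-∋ : (ng : ¬ Z G g) → C* g ng g
  C*-∋ {g} ng = proj₁ (proj₂ (proj₁ (proj₂ (hyp g ng))))

  Z⊆C* : (ng : ¬ Z G g) → Z G ⊆ C* g ng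
  Z⊆C* {g} ng = proj₂ (proj₂ (proj₁ (proj₂ (hyp g ng))))

  C*-isMu : (ng : ¬ Z G g) → IsMu G (C* g ng)
  C*-isMu {g} ng = μ-of-centralizer⇒μ (C*-∋ ng) (proj₁ (proj₁ (proj₂ (hyp g ng))))

  C*-unique : (ng : ¬ Z G g) → IsMu G C → C g → Z G ⊆ C → C ≐ C* g ng
  C*-unique {g} ng m Cg Z⊆C =
    proj₂ (proj₂ (hyp g ng)) _ (μ⇒μ-of-centralizer Cg m) Cg Z⊆C

  ⟨generator⟩≐C* : (ng : ¬ Z G g) → ⟨ G ⟩ (generator (C*-isMu ng)) ≐ C* g ng
  ⟨generator⟩≐C* ng = ≐-sym (generator-spans (C*-isMu ng))

  generator-noncentral : (m : IsMu G C) → ¬ Z G (generator m)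
  generator-noncentral m zh = nonabelian λ x → Z-stable (λ nzx → nzx (x∈Z nzx))
    where
    x∈Z : ∀ {x} (nzx : ¬ Z G x) → Z G x
    x∈Z nzx =
      let C*≐C = ≐-trans (≐-sym (⟨generator⟩≐C* nzx))
                   (μ-absorbs m tt (proj₂ (⟨generator⟩≐C* nzx) (Z⊆C* nzx zh)))
      in ⟨central⟩⊆Z zh (proj₁ (generator-spans m) (proj₁ C*≐C (C*-∋ nzx)))

  μ≐C* : (m : IsMu G C) → C ≐ C* (generator m) (generator-noncentral m)
  μ≐C* m =
    let ng = generator-noncentral m
    in ≐-trans (≐-sym (μ-absorbs m tt (proj₂ (⟨generator⟩≐C* ng) (C*-∋ ng))))
               (⟨generator⟩≐C* ng)

  Z⊆μ : IsMu G C → Z G ⊆ C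
  Z⊆μ m zx = proj₂ (μ≐C* m) (Z⊆C* (generator-noncentral m) zx)

  petals-meet-in-Z : IsMu G Ci → IsMu G Cj → ¬ (Ci ≐ Cj) → (Ci ∩ Cj) ≐ Z G
  petals-meet-in-Z mi mj Ci≉Cj =
    (λ (xi , xj) → Z-stable λ nzx →
       Ci≉Cj (≐-trans (C*-unique nzx mi xi (Z⊆μ mi))
                      (≐-sym (C*-unique nzx mj xj (Z⊆μ mj))))) ,
    (λ zx → Z⊆μ mi zx , Z⊆μ mj zx)

proposition3p4 : (G : FiniteGroup) → ¬ Abelian G →
    (hyp : (g : Elt G) → ¬ Z G g → Σ (Subset G) (IsCStar G g)) →
    IsFlowerWithPistil G (Z G) ×
    ((∀ (C : Subset G) → IsMu G C →
        Σ (Elt G) λ g → Σ (¬ Z G g) λ ng → C ≐ proj₁ (hyp g ng)) ×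
     (∀ (g : Elt G) (ng : ¬ Z G g) → IsMu G (proj₁ (hyp g ng))))
proposition3p4 G nonabelian hyp =
  ((λ cyclic → nonabelian (cyclic⇒abelian cyclic)) , Z-isSubgroup , λ _ _ → petals-meet-in-Z) ,
  (λ _ m → generator m , generator-noncentral m , μ≐C* m) ,
  (λ _ → C*-isMu)
  where
  open GroupFacts G
  open Petals G nonabelian hyp
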